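{- Let $\mathbb{F}$ be a field of positive characteristic $p$ and $S=\{R_0,\dots,R_d\}$ an association scheme on a finite set $X$. Let $T$ be a closed subset of $S$ with $O^\vartheta(S)\cup S_{p'}\subseteq T$, let $V_T=\{0\le i\le d: R_i\in T\}$ and $w_T=\sum_{i\in V_T}\overline{A_i}\in\mathbb{F}S$. Then $\langle w_T\rangle_{\mathbb{F}}$ is a trivial $\mathbb{F}S$-submodule of the regular $\mathbb{F}S$-module, i.e. $\overline{A_a}w_T=\overline{k_a}w_T$ for all $0\le a\le d$.
   Context: $S$ is an association scheme on $X$ with diagonal $R_0$, transposes $R_{i^*}$, intersection numbers $p_{ij}^k$, valencies $k_i=p_{ii^*}^0$. $S_{p'}=\{R_i\in S:p\nmid k_i\}$. For nonempty $U,V\subseteq S$, $UV=\{R_k:\exists R_u\in U,R_v\in V,\ p_{uv}^k>0\}$. A nonempty $T\subseteq S$ is closed if $T^*T\subseteq T$ ($T^*=\{R_{i^*}:R_i\in T\}$), strongly normal if also $R_{i^*}TR_i\subseteq T$ for all $i$ ($R_i$ standing for $\{R_i\}$). $O^\vartheta(S)$ is the intersection of all strongly normal closed subsets. $\overline{A_i}$ is the image in $M_X(\mathbb{F})$ of the adjacency matrix of $R_i$, $\mathbb{F}S=\mathrm{span}_{\mathbb{F}}\{\overline{A_i}\}$, $\overline{k_i}$ the image of $k_i$ in $\mathbb{F}$. -}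

module Defs where

open import Level using (Level; _⊔_)
open import Algebra.Bundles using (CommutativeRing)
open import Data.Nat using (ℕ; zero; suc; _+_; _<_; _>_)
open import Data.Nat.Divisibility using (_∣_)
open import Data.Fin using (Fin; zero; suc; _≟_)
open import Data.Fin.Subset using (Subset; _∈_; _∉_)
open import Data.Fin.Subset.Properties using (_∈?_)
open import Data.Bool using (Bool; true; false; if_then_else_)
open import Data.Product using (Σ; ∃; ∃-syntax; _×_; _,_)
open import Relation.Nullary using (¬_; Dec; yes; no)
open import Relation.Nullary.Decidable using (⌊_⌋)
open import Relation.Binary.PropositionalEquality using (_≡_)
import Algebra.Definitions.RawMonoid as RM

record Field (c ℓ : Level) : Set (Level.suc (c ⊔ ℓ)) where
  field
    commRing : CommutativeRing c ℓ
  open CommutativeRing commRing public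
  field
    1≉0     : ¬ (1# ≈ 0#)
    inverse : ∀ x → ¬ (x ≈ 0#) → ∃[ y ] (x * y ≈ 1#)

  ι : ℕ → Carrier
  ι n = RM._×_ +-rawMonoid n 1#

  Σ[_] : ∀ {n} → (Fin n → Carrier) → Carrier
  Σ[_] = RM.sum +-rawMonoid

HasCharacteristic : ∀ {c ℓ} → Field c ℓ → ℕ → Set ℓ
HasCharacteristic F p =
  (p > 0) × (ι p ≈ 0#) × (∀ m → m > 0 → m < p → ¬ (ι m ≈ 0#))
  where open Field F

count : ∀ {n} → (Fin n → Bool) → ℕ
count {zero}  f = 0
count {suc n} f = (if f zero then 1 else 0) + count (λ z → f (suc z))

-- Association schemes.
-- X = Fin n; S = {R_0, …, R_d} indexed by Fin (suc d).
-- rel x y = the index i with (x , y) ∈ R_i (so the R_i partition X × X).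

record AssociationScheme (n d : ℕ) : Set where
  field
    rel      : Fin n → Fin n → Fin (suc d)
    diagonal : ∀ x y → (rel x y ≡ zero → x ≡ y) × (x ≡ y → rel x y ≡ zero)
    nonempty : ∀ i → ∃[ x ] ∃[ y ] (rel x y ≡ i)
    _*       : Fin (suc d) → Fin (suc d)
    transpose : ∀ x y → rel y x ≡ (rel x y) *
    p        : Fin (suc d) → Fin (suc d) → Fin (suc d) → ℕ
    intersection : ∀ i j x y →
      count (λ z → ⌊ rel x z ≟ i ⌋ Data.Bool.∧ ⌊ rel z y ≟ j ⌋) ≡ p i j (rel x y)

  valency : Fin (suc d) → ℕ
  valency i = p i (i *) zero

  -- products of subsets of S (as predicates): R_k ∈ UV
  InProd : (Fin (suc d) → Set) → (Fin (suc d) → Set) → Fin (suc d) → Set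
  InProd U V k = ∃[ u ] ∃[ v ] (U u × V v × p u v k > 0)

  ⟦_⟧ : Fin (suc d) → Fin (suc d) → Set
  ⟦ i ⟧ j = j ≡ i

  mem : Subset (suc d) → Fin (suc d) → Set
  mem T i = i ∈ T

  Closed : Subset (suc d) → Set
  Closed T = (∃[ i ] (i ∈ T))
           × (∀ k → InProd (λ i → ∃[ t ] (t ∈ T × i ≡ t *)) (mem T) k → k ∈ T)

  StronglyNormal : Subset (suc d) → Set
  StronglyNormal T = Closed T
    × (∀ i k → InProd (InProd ⟦ i * ⟧ (mem T)) ⟦ i ⟧ k → k ∈ T)

  InOθ : Fin (suc d) → Set
  InOθ k = ∀ (U : Subset (suc d)) → StronglyNormal U → k ∈ U

  InSp' : ℕ → Fin (suc d) → Set
  InSp' q i = ¬ (q ∣ valency i)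

module _ {c ℓ} (F : Field c ℓ) {n d : ℕ} (S : AssociationScheme n d) where
  open Field F
  open AssociationScheme S

  Matrix : Set c
  Matrix = Fin n → Fin n → Carrier

  adj : Fin (suc d) → Matrix
  adj i x y = if ⌊ rel x y ≟ i ⌋ then 1# else 0#

  wT : Subset (suc d) → Matrix
  wT T x y = Σ[ (λ i → if ⌊ i ∈? T ⌋ then adj i x y else 0#) ]

  _⊗_ : Matrix → Matrix → Matrix
  (M ⊗ N) x y = Σ[ (λ z → M x z * N z y) ]

  _·ₘ_ : Carrier → Matrix → Matrix
  (a ·ₘ M) x y = a * M x y

  _≈ₘ_ : Matrix → Matrix → Set ℓ
  M ≈ₘ N = ∀ x y → M x y ≈ N x y

-- The (x, y) entry of A_a w_T counts the z with (x, z) ∈ R_a and R_{rel z y} ∈ T.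
-- If a ∈ T, closedness of T gives R_{rel z y} ∈ T ⇔ R_{rel x y} ∈ T for every such z,
-- so the entry is k_a or 0 exactly as w_T prescribes. If a ∉ T, then p ∣ k_a because
-- S_{p'} ⊆ T; moreover for two such z, z' the relation R_{rel z z'} lies in
-- R_{a*} R_0 R_a, hence in every strongly normal closed subset, hence in O^ϑ(S) ⊆ T.
-- So whether R_{rel z y} ∈ T is the same for all k_a such z, and the entry is 0 or
-- k_a, both of which vanish in 𝔽.
module Submission where

open import Defs
open import Data.Nat using (ℕ)
open import Data.Fin using (Fin)
open import Data.Fin.Subset using (Subset; _∈_)
open import Data.Product using (_×_)
open import Data.Sum using (_⊎_)

open import Data.Bool using (Bool; true; false; T; _∧_; if_then_else_)
open import Data.Bool.Properties using (T-∧)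
open import Data.Empty using (⊥-elim)
open import Data.Fin using (zero; suc; _≟_; punchIn)
open import Data.Fin.Properties using (punchInᵢ≢i; any?)
open import Data.Fin.Subset using (_∉_)
open import Data.Fin.Subset.Properties using (_∈?_)
open import Data.Nat as ℕ using (_<_; s≤s; z≤n)
open import Data.Nat.Divisibility using (_∣_; _∣?_; divides)
open import Data.Nat.Properties using (≤-trans; m≤n+m)
open import Data.Product using (∃-syntax; _,_; proj₁; proj₂)
open import Data.Sum using (inj₁; inj₂)
open import Function using (_∘_; Equivalence)
open import Relation.Nullary using (¬_; yes; no)
open import Relation.Nullary.Decidable using (⌊_⌋; fromWitness; _×-dec_)
open import Relation.Unary using (Pred; Decidable)
open import Relation.Binary.PropositionalEquality as ≡ using (_≡_; _≢_)
import Relation.Binary.Reasoning.Setoid as SetoidReasoning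
import Algebra.Properties.Semiring.Mult as SemiringMult
import Algebra.Properties.Semiring.Sum as SemiringSum

count-cong : ∀ {n} {f g : Fin n → Bool} → (∀ z → f z ≡ g z) → count f ≡ count g
count-cong {ℕ.zero}  f≗g = ≡.refl
count-cong {ℕ.suc n} f≗g =
  ≡.cong₂ ℕ._+_ (≡.cong (λ b → if b then 1 else 0) (f≗g zero)) (count-cong (f≗g ∘ suc))

count-false : ∀ n → count {n} (λ _ → false) ≡ 0
count-false ℕ.zero    = ≡.refl
count-false (ℕ.suc n) = count-false n

count-positive : ∀ {n} (f : Fin n → Bool) z → T (f z) → 0 < count f
count-positive f zero t with f zero
... | true = s≤s z≤n
count-positive f (suc z) t =
  ≤-trans (count-positive (f ∘ suc) z t) (m≤n+m _ (if f zero then 1 else 0))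

module _ {a b} {n} {P : Pred (Fin n) a} {Q : Pred (Fin n) b}
         (P? : Decidable P) (Q? : Decidable Q) where

  count-∧-⊆ : (∀ z → P z → Q z) →
    count (λ z → ⌊ P? z ⌋ ∧ ⌊ Q? z ⌋) ≡ count (λ z → ⌊ P? z ⌋)
  count-∧-⊆ P⊆Q = count-cong pointwise
    where
    pointwise : ∀ z → ⌊ P? z ⌋ ∧ ⌊ Q? z ⌋ ≡ ⌊ P? z ⌋
    pointwise z with P? z | Q? z
    ... | no _  | _      = ≡.refl
    ... | yes _ | yes _  = ≡.refl
    ... | yes pz | no ¬qz = ⊥-elim (¬qz (P⊆Q z pz))

  count-∧-disjoint : (∀ z → P z → ¬ Q z) → count (λ z → ⌊ P? z ⌋ ∧ ⌊ Q? z ⌋) ≡ 0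
  count-∧-disjoint disjoint = ≡.trans (count-cong pointwise) (count-false n)
    where
    pointwise : ∀ z → ⌊ P? z ⌋ ∧ ⌊ Q? z ⌋ ≡ false
    pointwise z with P? z | Q? z
    ... | no _   | _     = ≡.refl
    ... | yes _  | no _  = ≡.refl
    ... | yes pz | yes qz = ⊥-elim (disjoint z pz qz)

module FieldProperties {c ℓ} (F : Field c ℓ) where
  open Field F hiding (zero)
  open SetoidReasoning setoid
  open SemiringMult semiring using (×1-homo-*)
  open SemiringSum semiring using (sum-remove; sum-cong-≋; sum-replicate-zero)

  indicator : Bool → Carrier
  indicator b = if b then 1# else 0#

  indicator-∧ : ∀ b b′ → indicator b * indicator b′ ≈ indicator (b ∧ b′)
  indicator-∧ true  true  = *-identityˡ 1#
  indicator-∧ true  false = *-identityˡ 0#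
  indicator-∧ false b′    = zeroˡ _

  sum-indicator : ∀ {n} (f : Fin n → Bool) → Σ[ indicator ∘ f ] ≈ ι (count f)
  sum-indicator {ℕ.zero} f = refl
  sum-indicator {ℕ.suc n} f with f zero
  ... | true  = +-congˡ (sum-indicator (f ∘ suc))
  ... | false = trans (+-identityˡ _) (sum-indicator (f ∘ suc))

  sum-single : ∀ {n} (r : Fin (ℕ.suc n)) (f : Fin (ℕ.suc n) → Carrier) →
    (∀ i → i ≢ r → f i ≈ 0#) → Σ[ f ] ≈ f r
  sum-single {n} r f vanishes = begin
    Σ[ f ]                                 ≈⟨ sum-remove f ⟩
    f r + Σ[ f ∘ punchIn r ]      ≈⟨ +-congˡ rest≈0 ⟩
    f r + 0#                               ≈⟨ +-identityʳ _ ⟩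
    f r                                    ∎
    where
    rest≈0 : Σ[ f ∘ punchIn r ] ≈ 0#
    rest≈0 = trans (sum-cong-≋ (λ i → vanishes _ (punchInᵢ≢i r i))) (sum-replicate-zero n)

  ι-≡0⊎≡ : ∀ {m k} → ι k ≈ 0# → m ≡ 0 ⊎ m ≡ k → ι m ≈ 0#
  ι-≡0⊎≡ _    (inj₁ ≡.refl) = refl
  ι-≡0⊎≡ ιk≈0 (inj₂ ≡.refl) = ιk≈0

  ι-multiple : ∀ {m k} → m ∣ k → ι m ≈ 0# → ι k ≈ 0#
  ι-multiple {m} (divides q ≡.refl) ιm≈0 = begin
    ι (q ℕ.* m)  ≈⟨ ×1-homo-* q m ⟩
    ι q * ι m    ≈⟨ *-congˡ ιm≈0 ⟩
    ι q * 0#     ≈⟨ zeroʳ _ ⟩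
    0#           ∎

module SchemeProperties {n d} (S : AssociationScheme n d) where
  open AssociationScheme S

  TransposeOf : Subset (ℕ.suc d) → Fin (ℕ.suc d) → Set
  TransposeOf U i = ∃[ t ] (t ∈ U × i ≡ t *)

  rel-diag : ∀ x → rel x x ≡ zero
  rel-diag x = proj₂ (diagonal x x) ≡.refl

  p-rel-positive : ∀ x z y → 0 < p (rel x z) (rel z y) (rel x y)
  p-rel-positive x z y = ≡.subst (0 <_) (intersection (rel x z) (rel z y) x y)
    (count-positive _ z (Equivalence.from T-∧ (fromWitness {a? = rel x z ≟ rel x z} ≡.refl ,
                                              fromWitness {a? = rel z y ≟ rel z y} ≡.refl)))

  rel-InProd : ∀ {U V : Fin (ℕ.suc d) → Set} x z y →
    U (rel x z) → V (rel z y) → InProd U V (rel x y)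
  rel-InProd x z y u v = rel x z , rel z y , u , v , p-rel-positive x z y

  rel-TransposeOf : ∀ {U} x y → rel x y ∈ U → TransposeOf U (rel y x)
  rel-TransposeOf x y xy∈U = rel x y , xy∈U , transpose x y

  module _ {U : Subset (ℕ.suc d)} (closed : Closed U) where

    closed-rel-diag : ∀ x → rel x x ∈ U
    closed-rel-diag x with proj₁ closed
    ... | i , i∈U with nonempty i
    ...   | y , x′ , ≡.refl = ≡.subst (_∈ U) (≡.trans (rel-diag x′) (≡.sym (rel-diag x)))
      (proj₂ closed (rel x′ x′) (rel-InProd x′ y x′ (rel-TransposeOf y x′ i∈U) i∈U))

    closed-rel-sym : ∀ {x y} → rel x y ∈ U → rel y x ∈ U
    closed-rel-sym {x} {y} xy∈U =
      proj₂ closed (rel y x) (rel-InProd y x x (rel-TransposeOf x y xy∈U) (closed-rel-diag x))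

    closed-rel-trans : ∀ {u v w} → rel u v ∈ U → rel v w ∈ U → rel u w ∈ U
    closed-rel-trans {u} {v} {w} uv∈U vw∈U =
      proj₂ closed (rel u w) (rel-InProd u v w (rel-TransposeOf v u (closed-rel-sym uv∈U)) vw∈U)

  fiber-InOθ : ∀ {a x z z′} → rel x z ≡ a → rel x z′ ≡ a → InOθ (rel z z′)
  fiber-InOθ {x = x} {z} {z′} ≡.refl xz′≡a U (closed , normal) =
    normal (rel x z) (rel z z′)
      (rel-InProd z x z′ (rel-InProd z x x (transpose x z) (closed-rel-diag closed x)) xz′≡a)

  valency≡count : ∀ a x → valency a ≡ count (λ z → ⌊ rel x z ≟ a ⌋)
  valency≡count a x = begin
    p a (a *) zero                                     ≡⟨ ≡.cong (p a (a *)) (rel-diag x) ⟨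
    p a (a *) (rel x x)                                ≡⟨ intersection a (a *) x x ⟨
    count (λ z → ⌊ rel x z ≟ a ⌋ ∧ ⌊ rel z x ≟ a * ⌋)   ≡⟨ count-∧-⊆ _ _ xz≡a⇒zx≡a* ⟩
    count (λ z → ⌊ rel x z ≟ a ⌋)                      ∎
    where
    open ≡.≡-Reasoning
    xz≡a⇒zx≡a* : ∀ z → rel x z ≡ a → rel z x ≡ a *
    xz≡a⇒zx≡a* z xz≡a = ≡.trans (transpose x z) (≡.cong _* xz≡a)

  module _ (T : Subset (ℕ.suc d)) where

    paths : Fin (ℕ.suc d) → Fin n → Fin n → ℕ
    paths a x y = count (λ z → ⌊ rel x z ≟ a ⌋ ∧ ⌊ rel z y ∈? T ⌋)

    module _ (closed : Closed T) {a : Fin (ℕ.suc d)} {x y : Fin n} where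

      private
        xz≟a : Decidable (λ z → rel x z ≡ a)
        xz≟a z = rel x z ≟ a

        zy∈?T : Decidable (λ z → rel z y ∈ T)
        zy∈?T z = rel z y ∈? T

      paths-∈ : a ∈ T → rel x y ∈ T → paths a x y ≡ valency a
      paths-∈ a∈T xy∈T = ≡.trans (count-∧-⊆ xz≟a zy∈?T zy∈T) (≡.sym (valency≡count a x))
        where
        zy∈T : ∀ z → rel x z ≡ a → rel z y ∈ T
        zy∈T z ≡.refl = closed-rel-trans closed (closed-rel-sym closed a∈T) xy∈T

      paths-∉ : a ∈ T → rel x y ∉ T → paths a x y ≡ 0
      paths-∉ a∈T xy∉T = count-∧-disjoint xz≟a zy∈?T zy∉T
        where
        zy∉T : ∀ z → rel x z ≡ a → rel z y ∉ T
        zy∉T z ≡.refl zy∈T = xy∉T (closed-rel-trans closed a∈T zy∈T)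

      paths≡0⊎valency : (∀ i → InOθ i → i ∈ T) → paths a x y ≡ 0 ⊎ paths a x y ≡ valency a
      paths≡0⊎valency Oθ⊆T with any? (λ z → xz≟a z ×-dec zy∈?T z)
      ... | no ∄z = inj₁ (count-∧-disjoint xz≟a zy∈?T (λ z xz≡a zy∈T → ∄z (z , xz≡a , zy∈T)))
      ... | yes (z₀ , xz₀≡a , z₀y∈T) =
        inj₂ (≡.trans (count-∧-⊆ xz≟a zy∈?T zy∈T) (≡.sym (valency≡count a x)))
        where
        zy∈T : ∀ z → rel x z ≡ a → rel z y ∈ T
        zy∈T z xz≡a = closed-rel-trans closed (Oθ⊆T _ (fiber-InOθ xz≡a xz₀≡a)) z₀y∈T

module Entries {c ℓ} (F : Field c ℓ) {n d} (S : AssociationScheme n d) (T : Subset (ℕ.suc d)) where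
  open Field F hiding (zero)
  open FieldProperties F
  open AssociationScheme S using (rel)
  open SchemeProperties S using (paths)
  open SetoidReasoning setoid

  wT-entry : ∀ x y → wT F S T x y ≈ indicator ⌊ rel x y ∈? T ⌋
  wT-entry x y = trans (sum-single (rel x y) _ vanishes) diagonal-term
    where
    vanishes : ∀ i → i ≢ rel x y → (if ⌊ i ∈? T ⌋ then adj F S i x y else 0#) ≈ 0#
    vanishes i i≢xy with i ∈? T | rel x y ≟ i
    ... | no _  | _        = refl
    ... | yes _ | no _     = refl
    ... | yes _ | yes xy≡i = ⊥-elim (i≢xy (≡.sym xy≡i))
    diagonal-term : (if ⌊ rel x y ∈? T ⌋ then adj F S (rel x y) x y else 0#)
                  ≈ indicator ⌊ rel x y ∈? T ⌋
    diagonal-term with rel x y ≟ rel x y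
    ... | yes _   = refl
    ... | no xy≢xy = ⊥-elim (xy≢xy ≡.refl)

  adj⊗wT-entry : ∀ a x y → _⊗_ F S (adj F S a) (wT F S T) x y ≈ ι (paths T a x y)
  adj⊗wT-entry a x y = begin
    Σ[ (λ z → adj F S a x z * wT F S T z y) ]  ≈⟨ sum-cong-≋ product ⟩
    Σ[ indicator ∘ xz≡a∧zy∈T ]                 ≈⟨ sum-indicator xz≡a∧zy∈T ⟩
    ι (paths T a x y)                          ∎
    where
    xz≡a∧zy∈T : Fin n → Bool
    xz≡a∧zy∈T z = ⌊ rel x z ≟ a ⌋ ∧ ⌊ rel z y ∈? T ⌋
    open SemiringSum semiring using (sum-cong-≋)
    product : ∀ z → adj F S a x z * wT F S T z y ≈ indicator (xz≡a∧zy∈T z)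
    product z = trans (*-congˡ (wT-entry z y)) (indicator-∧ _ _)

module TrivialAction {c ℓ} (F : Field c ℓ) {p : ℕ} (ιp≈0 : Field._≈_ F (Field.ι F p) (Field.0# F))
                    {n d} (S : AssociationScheme n d) (T : Subset (ℕ.suc d))
                    (closed : AssociationScheme.Closed S T)
                    (Oθ∪Sp′⊆T : ∀ i → AssociationScheme.InOθ S i ⊎ AssociationScheme.InSp' S p i →
                                    i ∈ T)
                    where
  open Field F hiding (zero)
  open FieldProperties F
  open AssociationScheme S using (rel; valency)
  open SchemeProperties S

  ι-valency-∉ : ∀ {a} → a ∉ T → ι (valency a) ≈ 0#
  ι-valency-∉ {a} a∉T with p ∣? valency a
  ... | yes p∣k = ι-multiple p∣k ιp≈0
  ... | no  p∤k = ⊥-elim (a∉T (Oθ∪Sp′⊆T a (inj₂ p∤k)))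

  ι-paths : ∀ a x y → ι (paths T a x y) ≈ ι (valency a) * indicator ⌊ rel x y ∈? T ⌋
  ι-paths a x y with a ∈? T | rel x y ∈? T
  ... | yes a∈T | yes xy∈T =
    trans (reflexive (≡.cong ι (paths-∈ T closed a∈T xy∈T))) (sym (*-identityʳ _))
  ... | yes a∈T | no  xy∉T =
    trans (reflexive (≡.cong ι (paths-∉ T closed a∈T xy∉T))) (sym (zeroʳ _))
  ... | no  a∉T | _ =
    trans (ι-≡0⊎≡ (ι-valency-∉ a∉T) (paths≡0⊎valency T closed (λ i → Oθ∪Sp′⊆T i ∘ inj₁)))
          (sym (trans (*-congʳ (ι-valency-∉ a∉T)) (zeroˡ _)))

lemma4p2 : ∀ {c ℓ} (F : Field c ℓ) (p : ℕ) → HasCharacteristic F p →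
    ∀ {n d : ℕ} (S : AssociationScheme n d) (T : Subset (ℕ.suc d)) →
    AssociationScheme.Closed S T →
    (∀ i → (AssociationScheme.InOθ S i ⊎ AssociationScheme.InSp' S p i) → i ∈ T) →
    ∀ (a : Fin (ℕ.suc d)) →
      _≈ₘ_ F S (_⊗_ F S (adj F S a) (wT F S T))
               (_·ₘ_ F S (Field.ι F (AssociationScheme.valency S a)) (wT F S T))
lemma4p2 F p (_ , ιp≈0 , _) S T closed Oθ∪Sp′⊆T a x y = begin
  _⊗_ F S (adj F S a) (wT F S T) x y          ≈⟨ adj⊗wT-entry a x y ⟩
  ι (paths T a x y)                           ≈⟨ ι-paths a x y ⟩
  ι (valency a) * indicator ⌊ rel x y ∈? T ⌋  ≈⟨ *-congˡ (sym (wT-entry x y)) ⟩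
  ι (valency a) * wT F S T x y                ∎
  where
  open Field F hiding (zero)
  open FieldProperties F using (indicator)
  open AssociationScheme S using (rel; valency)
  open SchemeProperties S using (paths)
  open Entries F S T
  open TrivialAction F ιp≈0 S T closed Oθ∪Sp′⊆T
  open SetoidReasoning setoid
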